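{- Let $\mathbf{h}$ be a weakly increasing sequence of positive integers with $\mathbf{h}(i)>i$ for all $i$, let $S$ be a nonempty $\mathbf{h}$-admissible set and $m=\mathbf{m}(S)$. For all $n\ge\mathbf{h}(m)$ and all $k$, we have $B_k(S,n)\neq\varnothing$ only if $\mathbf{h}(m)-m\le k\le\mathbf{h}(m)$. Furthermore, for each such $k$ there is a bijection $$B_k(S,n)\to B_k(S,\mathbf{h}(m))\times\binom{[k+1,n]}{n-\mathbf{h}(m)},$$ where $\binom{[k+1,n]}{r}$ denotes the set of $r$-element subsets of $\{k+1,\dots,n\}$.
   Context: $\mathcal{P}_\mathbf{h}=\{(i,j): i<j\le \mathbf{h}(i)\}$. For $\pi\in S_n$ (one-line notation $\pi_1\cdots\pi_n$), $\mathrm{inv}_\mathbf{h}(\pi)=\{(i,j)\in\mathcal{P}_\mathbf{h}: j\le n,\ \pi_i>\pi_j\}$. $S\subseteq\mathcal{P}_\mathbf{h}$ is $\mathbf{h}$-admissible if $S=\mathrm{inv}_\mathbf{h}(\pi)$ for some permutation $\pi$ of some $S_n$. $I_\mathbf{h}(S,n)=\{\pi\in S_n:\mathrm{inv}_\mathbf{h}(\pi)=S\}$. $\mathbf{m}(S)=\max\{i:(i,i+1)\in S\}$. $B_k(S,n)=\{\pi\in I_\mathbf{h}(S,n):\pi_{\mathbf{h}(m)}=k\}$. -}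

module Defs where

open import Level using (0ℓ)
open import Data.Nat using (ℕ; zero; suc; _≤_; _<_)
open import Data.Fin using (Fin; toℕ)
open import Data.Fin.Subset using (Subset; _∈_; ∣_∣)
open import Data.Vec using (Vec; lookup; toList)
open import Data.List using (List; map; upTo)
open import Data.List.Relation.Binary.Permutation.Propositional using (_↭_)
open import Data.Product using (Σ; ∃; ∃-syntax; _×_; proj₁)
open import Relation.Binary.PropositionalEquality using (_≡_)
open import Function.Bundles using (_⇔_)

-- h is indexed by the positive integers; hypotheses are imposed for i ≥ 1.
WeaklyIncreasing : (ℕ → ℕ) → Set
WeaklyIncreasing h = ∀ i j → 1 ≤ i → i ≤ j → h i ≤ h j

Expansive : (ℕ → ℕ) → Set
Expansive h = ∀ i → 1 ≤ i → i < h i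

PairSet : Set₁
PairSet = ℕ → ℕ → Set

-- One-line notation: π = π₁ ⋯ πₙ is stored as a vector of length n;
-- position i (1-based) is the Fin index i-1.
-- π ∈ Sₙ : the entries are a rearrangement of 1,…,n.
IsPerm : (n : ℕ) → Vec ℕ n → Set
IsPerm n π = toList π ↭ map suc (upTo n)

InvH : (h : ℕ → ℕ) {n : ℕ} → Vec ℕ n → PairSet
InvH h {n} π i j =
  Σ (Fin n) λ a → Σ (Fin n) λ b →
    (i ≡ suc (toℕ a)) × (j ≡ suc (toℕ b)) × (i < j) × (j ≤ h i) ×
    (lookup π b < lookup π a)

InvEq : (h : ℕ → ℕ) {n : ℕ} → Vec ℕ n → PairSet → Set
InvEq h π S = ∀ i j → S i j ⇔ InvH h π i j

Admissible : (ℕ → ℕ) → PairSet → Set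
Admissible h S = Σ ℕ λ n → Σ (Vec ℕ n) λ π → IsPerm n π × InvEq h π S

NonemptyPS : PairSet → Set
NonemptyPS S = Σ ℕ λ i → Σ ℕ λ j → S i j

IsM : PairSet → ℕ → Set
IsM S m = S m (suc m) × (∀ i → S i (suc i) → i ≤ m)

InI : (h : ℕ → ℕ) (S : PairSet) (n : ℕ) → Vec ℕ n → Set
InI h S n π = IsPerm n π × InvEq h π S

-- π ∈ B_k(S,n), with m = 𝐦(S) given explicitly: π ∈ I_h(S,n) and π_{h(m)} = k.
InB : (h : ℕ → ℕ) (S : PairSet) (m k n : ℕ) → Vec ℕ n → Set
InB h S m k n π =
  InI h S n π × (Σ (Fin n) λ a → (suc (toℕ a) ≡ h m) × (lookup π a ≡ k))

-- Subsets of [1,n] are Subset n (Fin index a stands for a+1).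
-- p ∈ binom([k+1,n], r): every element lies in [k+1,n] and |p| = r.
InBinom : (n k r : ℕ) → Subset n → Set
InBinom n k r p = (∀ a → a ∈ p → suc k ≤ suc (toℕ a)) × (∣ p ∣ ≡ r)

_⊗_ : {X Y : Set} → (X → Set) → (Y → Set) → X × Y → Set
(A ⊗ B) xy = A (proj₁ xy) × B (Data.Product.proj₂ xy)

record SubsetBij {X Y : Set} (A : X → Set) (B : Y → Set) : Set where
  field
    fun      : Σ X A → Σ Y B
    resp     : ∀ a a′ → proj₁ a ≡ proj₁ a′ → proj₁ (fun a) ≡ proj₁ (fun a′)
    injective : ∀ a a′ → proj₁ (fun a) ≡ proj₁ (fun a′) → proj₁ a ≡ proj₁ a′
    surjective : (b : Σ Y B) → Σ (Σ X A) λ a → proj₁ (fun a) ≡ proj₁ b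

-- Write H = h m. If π ∈ I_h(S, n) had a descent at some p > m, then (p, p + 1) ∈ P_h would be
-- an h-inversion beyond 𝐦(S); so π increases on [m + 1, n], and since h is weakly increasing every
-- h-inversion (i, j) of π has j ≤ H. Hence π is encoded by T = {π_{H+1}, …, π_n}, whose elements
-- all exceed k = π_H, together with the standardization σ of π₁ ⋯ π_H relative to the complement
-- of T: σ has the same h-inversions as π and σ_H = k. Conversely every such pair (σ, T) arises by
-- relabelling σ with the complement of T and appending T in increasing order. The bounds on k come
-- from π_{m+1} ≥ 1 and π_n ≤ n along the increasing run.

{-# OPTIONS --safe #-}
module Submission where

open import Data.Bool using (Bool; true; false; if_then_else_)
open import Data.Empty using (⊥-elim)
open import Data.Fin using (Fin; toℕ; fromℕ<) renaming (zero to fzero; suc to fsuc)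
open import Data.Fin.Properties using (toℕ<n; toℕ-fromℕ<)
open import Data.Fin.Subset using (Subset; ∁; ∣_∣) renaming (_∈_ to _∈ₛ_)
open import Data.Fin.Subset.Properties using (∣∁p∣≡n∸∣p∣; ⊆-antisym)
open import Data.List as List using (List; []; _∷_; _++_; length; map; upTo)
open import Data.List.Membership.Propositional using (_∈_)
open import Data.List.Membership.Propositional.Properties
  using (∈-map⁺; ∈-map⁻; ∈-upTo⁺; ∈-upTo⁻; ∈-∃++)
open import Data.List.Properties using (length-map; length-upTo)
open import Data.List.Relation.Binary.Permutation.Propositional
  using (_↭_; ↭-refl; ↭-prep; ↭-trans; ↭-sym; ↭⇒↭ₛ)
open import Data.List.Relation.Binary.Permutation.Propositional.Properties
  using (∈-resp-↭; ↭-length; shift)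
import Data.List.Relation.Binary.Permutation.Setoid.Properties as ↭ₛ
open import Data.List.Relation.Binary.Subset.Propositional using (_⊆_)
import Data.List.Relation.Unary.All as All
open import Data.List.Relation.Unary.AllPairs using ([]; _∷_)
open import Data.List.Relation.Unary.Any using (here; there)
open import Data.List.Relation.Unary.Unique.Propositional using (Unique)
import Data.List.Relation.Unary.Unique.Propositional.Properties as Unique
open import Data.Nat using (ℕ; zero; suc; _+_; _∸_; _≤_; _<_; _≤?_; _<?_; _≟_; z≤n; s≤s; z<s)
open import Data.Nat.Properties
open import Data.List.Membership.DecPropositional _≟_ using (_∈?_)
open import Data.Product using (Σ; _×_; _,_; proj₁; proj₂; ∃-syntax)
open import Data.Sum using (inj₁; inj₂)
open import Data.Vec using (Vec; []; _∷_; lookup; tabulate; toList; here; there)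
open import Data.Vec.Properties using (length-toList)
open import Function using (_∘_)
open import Function.Bundles using (_⇔_; mk⇔; Equivalence)
import Function.Properties.Equivalence as ⇔
open import Relation.Binary.Definitions using (tri<; tri≈; tri>)
open import Relation.Binary.PropositionalEquality
open import Relation.Nullary using (¬_; yes; no; does)
open import Relation.Nullary.Decidable using (dec-true; dec-false)

open import Defs

private variable
  A : Set
  n : ℕ

infixl 9 _!_

-- 1-based lookup; positions outside [1, n] give the junk value 0.
_!_ : Vec ℕ n → ℕ → ℕ
_        ! zero        = 0
[]       ! suc _       = 0
(x ∷ xs) ! suc zero    = x
(x ∷ xs) ! suc (suc q) = xs ! suc q

tabulate₁ : (n : ℕ) → (ℕ → A) → Vec A n
tabulate₁ n f = tabulate (λ a → f (suc (toℕ a)))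

!-lookup : (xs : Vec ℕ n) (a : Fin n) → xs ! suc (toℕ a) ≡ lookup xs a
!-lookup (x ∷ xs) fzero    = refl
!-lookup (x ∷ xs) (fsuc a) = !-lookup xs a

!-fromℕ< : (xs : Vec ℕ n) {q : ℕ} (q<n : q < n) → xs ! suc q ≡ lookup xs (fromℕ< q<n)
!-fromℕ< xs q<n = trans (cong (λ r → xs ! suc r) (sym (toℕ-fromℕ< q<n))) (!-lookup xs (fromℕ< q<n))

!-tabulate₁ : (f : ℕ → ℕ) {q : ℕ} → 1 ≤ q → q ≤ n → tabulate₁ n f ! q ≡ f q
!-tabulate₁ {n = suc n} f {suc zero}    _ _         = refl
!-tabulate₁ {n = suc n} f {suc (suc q)} _ (s≤s q≤n) = !-tabulate₁ (λ q → f (suc q)) z<s q≤n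

!-ext : (xs ys : Vec ℕ n) → (∀ {q} → 1 ≤ q → q ≤ n → xs ! q ≡ ys ! q) → xs ≡ ys
!-ext []       []       _  = refl
!-ext (x ∷ xs) (y ∷ ys) eq =
  cong₂ _∷_ (eq z<s (s≤s z≤n)) (!-ext xs ys λ where (s≤s z≤n) q≤n → eq z<s (s≤s q≤n))

!-∈-drop : (xs : Vec ℕ n) {p q : ℕ} → p < q → q ≤ n → xs ! q ∈ List.drop p (toList xs)
!-∈-drop (x ∷ xs) {zero}  {suc zero}    _         _         = here refl
!-∈-drop (x ∷ xs) {zero}  {suc (suc q)} _         (s≤s q≤n) = there (!-∈-drop xs z<s q≤n)
!-∈-drop (x ∷ xs) {suc p} {suc (suc q)} (s≤s p<q) (s≤s q≤n) = !-∈-drop xs p<q q≤n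

∈-drop⇒! : (xs : Vec ℕ n) (p : ℕ) {z : ℕ} →
           z ∈ List.drop p (toList xs) → ∃[ q ] p < q × q ≤ n × xs ! q ≡ z
∈-drop⇒! (x ∷ xs) zero (here refl) = 1 , z<s , s≤s z≤n , refl
∈-drop⇒! (x ∷ xs) zero (there z∈) with ∈-drop⇒! xs zero z∈
... | suc q , _ , q≤n , eq = suc (suc q) , z<s , s≤s q≤n , eq
∈-drop⇒! (x ∷ xs) (suc p) z∈ with ∈-drop⇒! xs p z∈
... | suc q , p<q , q≤n , eq = suc (suc q) , s≤s p<q , s≤s q≤n , eq

oneTo : ℕ → List ℕ
oneTo n = map suc (upTo n)

∈-oneTo⁺ : {z : ℕ} → 1 ≤ z → z ≤ n → z ∈ oneTo n
∈-oneTo⁺ {z = suc _} _ z<n = ∈-map⁺ suc (∈-upTo⁺ z<n)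

∈-oneTo⁻ : {z : ℕ} → z ∈ oneTo n → 1 ≤ z × z ≤ n
∈-oneTo⁻ z∈ with ∈-map⁻ suc z∈
... | _ , y∈ , refl = z<s , ∈-upTo⁻ y∈

unique-oneTo : ∀ n → Unique (oneTo n)
unique-oneTo n = Unique.map⁺ suc-injective (Unique.upTo⁺ n)

length-oneTo : ∀ n → length (oneTo n) ≡ n
length-oneTo n = trans (length-map suc (upTo n)) (length-upTo n)

unique-resp-↭ : {xs ys : List A} → xs ↭ ys → Unique xs → Unique ys
unique-resp-↭ xs↭ys = ↭ₛ.Unique-resp-↭ (setoid _) (↭⇒↭ₛ xs↭ys)

unique-⊆⇒↭ : {xs ys : List A} → Unique xs → Unique ys → xs ⊆ ys →
             length ys ≤ length xs → xs ↭ ys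
unique-⊆⇒↭ {xs = []}     {[]}    _ _ _ _ = ↭-refl
unique-⊆⇒↭ {xs = x ∷ xs} (x∉xs ∷ !xs) !ys xs⊆ys |ys|≤ with ∈-∃++ (xs⊆ys (here refl))
... | us , vs , refl =
  ↭-trans (↭-prep x (unique-⊆⇒↭ !xs !us++vs xs⊆us++vs |us++vs|≤)) (↭-sym (shift x us vs))
  where
  !us++vs : Unique (us ++ vs)
  !us++vs with unique-resp-↭ (shift x us vs) !ys
  ... | _ ∷ ! = !
  xs⊆us++vs : xs ⊆ us ++ vs
  xs⊆us++vs z∈xs with ∈-resp-↭ (shift x us vs) (xs⊆ys (there z∈xs))
  ... | here refl = ⊥-elim (All.lookup x∉xs z∈xs refl)
  ... | there z∈  = z∈
  |us++vs|≤ : length (us ++ vs) ≤ length xs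
  |us++vs|≤ = ≤-pred (subst (_≤ suc (length xs)) (↭-length (shift x us vs)) |ys|≤)

record Permutes (n : ℕ) (f : ℕ → ℕ) : Set where
  field
    bounded   : ∀ {q} → 1 ≤ q → q ≤ n → 1 ≤ f q × f q ≤ n
    injective : ∀ {p q} → 1 ≤ p → p ≤ n → 1 ≤ q → q ≤ n → f p ≡ f q → p ≡ q

unique⇒!-injective : (xs : Vec ℕ n) → Unique (toList xs) →
                     ∀ {p q} → 1 ≤ p → p ≤ n → 1 ≤ q → q ≤ n → xs ! p ≡ xs ! q → p ≡ q
unique⇒!-injective (x ∷ xs) _ {suc zero} {suc zero} _ _ _ _ _ = refl
unique⇒!-injective (x ∷ xs) (x∉xs ∷ _) {suc zero} {suc (suc q)} _ _ _ (s≤s q≤n) eq =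
  ⊥-elim (All.lookup x∉xs (!-∈-drop xs z<s q≤n) eq)
unique⇒!-injective (x ∷ xs) (x∉xs ∷ _) {suc (suc p)} {suc zero} _ (s≤s p≤n) _ _ eq =
  ⊥-elim (All.lookup x∉xs (!-∈-drop xs z<s p≤n) (sym eq))
unique⇒!-injective (x ∷ xs) (_ ∷ !xs) {suc (suc p)} {suc (suc q)} _ (s≤s p≤n) _ (s≤s q≤n) eq =
  cong suc (unique⇒!-injective xs !xs z<s p≤n z<s q≤n eq)

!-injective⇒unique : (xs : Vec ℕ n) →
                     (∀ {p q} → 1 ≤ p → p ≤ n → 1 ≤ q → q ≤ n → xs ! p ≡ xs ! q → p ≡ q) →
                     Unique (toList xs)
!-injective⇒unique [] _ = []
!-injective⇒unique (x ∷ xs) inj = All.tabulate x∉xs ∷ !-injective⇒unique xs inj′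
  where
  x∉xs : ∀ {z} → z ∈ toList xs → x ≢ z
  x∉xs z∈ x≡z with ∈-drop⇒! xs 0 z∈
  ... | suc q , _ , q≤n , refl = 0≢1+n (suc-injective (inj z<s (s≤s z≤n) z<s (s≤s q≤n) x≡z))
  inj′ : ∀ {p q} → 1 ≤ p → p ≤ _ → 1 ≤ q → q ≤ _ → xs ! p ≡ xs ! q → p ≡ q
  inj′ (s≤s z≤n) p≤n (s≤s z≤n) q≤n eq = suc-injective (inj z<s (s≤s p≤n) z<s (s≤s q≤n) eq)

isPerm⇒permutes : (π : Vec ℕ n) → IsPerm n π → Permutes n (π !_)
isPerm⇒permutes π π↭ = record
  { bounded   = λ 1≤q q≤n → ∈-oneTo⁻ (∈-resp-↭ π↭ (!-∈-drop π 1≤q q≤n))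
  ; injective = unique⇒!-injective π (unique-resp-↭ (↭-sym π↭) (unique-oneTo _))
  }

permutes⇒isPerm : (π : Vec ℕ n) → Permutes n (π !_) → IsPerm n π
permutes⇒isPerm {n} π perm =
  unique-⊆⇒↭ (!-injective⇒unique π injective) (unique-oneTo n) π⊆oneTo
             (≤-reflexive (trans (length-oneTo n) (sym (length-toList π))))
  where
  open Permutes perm
  π⊆oneTo : toList π ⊆ oneTo n
  π⊆oneTo z∈ with ∈-drop⇒! π 0 z∈
  ... | q , 1≤q , q≤n , refl = ∈-oneTo⁺ (proj₁ (bounded 1≤q q≤n)) (proj₂ (bounded 1≤q q≤n))

permutes-last : (π : Vec ℕ n) → Permutes n (π !_) → π ! n ≤ n
permutes-last []      _    = z≤n
permutes-last (_ ∷ _) perm = proj₂ (Permutes.bounded perm z<s ≤-refl)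

infix 4 _∈₁_ _∉₁_

-- Membership of a 1-based value v in a subset of Fin n, which stores v at index v - 1.
data _∈₁_ : ℕ → Subset n → Set where
  here  : {p : Subset n} → 1 ∈₁ (true ∷ p)
  there : {b : Bool} {p : Subset n} {v : ℕ} → suc v ∈₁ p → suc (suc v) ∈₁ (b ∷ p)

_∉₁_ : ℕ → Subset n → Set
v ∉₁ p = ¬ v ∈₁ p

Above : ℕ → Subset n → Set
Above k p = ∀ {v} → v ∈₁ p → k < v

∈₁-range : {p : Subset n} {v : ℕ} → v ∈₁ p → 1 ≤ v × v ≤ n
∈₁-range here        = z<s , s≤s z≤n
∈₁-range (there v∈p) = z<s , s≤s (proj₂ (∈₁-range v∈p))

∉₁⇒∈₁∁ : (p : Subset n) {v : ℕ} → 1 ≤ v → v ≤ n → v ∉₁ p → v ∈₁ ∁ p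
∉₁⇒∈₁∁ (true  ∷ p) {suc zero}    _ _         v∉p = ⊥-elim (v∉p here)
∉₁⇒∈₁∁ (false ∷ p) {suc zero}    _ _         _   = here
∉₁⇒∈₁∁ (_     ∷ p) {suc (suc v)} _ (s≤s v<n) v∉p = there (∉₁⇒∈₁∁ p z<s v<n (v∉p ∘ there))

∈₁∁⇒∉₁ : (p : Subset n) {v : ℕ} → v ∈₁ ∁ p → v ∉₁ p
∈₁∁⇒∉₁ (false ∷ p) here           ()
∈₁∁⇒∉₁ (true  ∷ p) (there v∈∁p) (there v∈p) = ∈₁∁⇒∉₁ p v∈∁p v∈p
∈₁∁⇒∉₁ (false ∷ p) (there v∈∁p) (there v∈p) = ∈₁∁⇒∉₁ p v∈∁p v∈p

∈ₛ⇒∈₁ : {p : Subset n} {a : Fin n} → a ∈ₛ p → suc (toℕ a) ∈₁ p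
∈ₛ⇒∈₁ here        = here
∈ₛ⇒∈₁ (there a∈p) = there (∈ₛ⇒∈₁ a∈p)

∈₁⇒∈ₛ : {p : Subset n} {a : Fin n} → suc (toℕ a) ∈₁ p → a ∈ₛ p
∈₁⇒∈ₛ {a = fzero}  here        = here
∈₁⇒∈ₛ {a = fsuc a} (there a∈p) = there (∈₁⇒∈ₛ a∈p)

∈₁⇒∃∈ₛ : {p : Subset n} {v : ℕ} → v ∈₁ p → ∃[ a ] suc (toℕ a) ≡ v × a ∈ₛ p
∈₁⇒∃∈ₛ here = fzero , refl , here
∈₁⇒∃∈ₛ (there v∈p) with ∈₁⇒∃∈ₛ v∈p
... | a , refl , a∈p = fsuc a , refl , there a∈p

∈₁-ext : (p q : Subset n) → (∀ {v} → v ∈₁ p → v ∈₁ q) → (∀ {v} → v ∈₁ q → v ∈₁ p) → p ≡ q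
∈₁-ext p q p⊆q q⊆p = ⊆-antisym (∈₁⇒∈ₛ ∘ p⊆q ∘ ∈ₛ⇒∈₁) (∈₁⇒∈ₛ ∘ q⊆p ∘ ∈ₛ⇒∈₁)

∈₁-tabulate₁⁺ : (f : ℕ → Bool) {v : ℕ} → 1 ≤ v → v ≤ n → f v ≡ true → v ∈₁ tabulate₁ n f
∈₁-tabulate₁⁺ {n = suc n} f {suc zero}    _ _         f1 with f 1 | f1
... | true | refl = here
∈₁-tabulate₁⁺ {n = suc n} f {suc (suc v)} _ (s≤s v<n) fv =
  there (∈₁-tabulate₁⁺ (λ v → f (suc v)) z<s v<n fv)

∈₁-tabulate₁⁻ : (f : ℕ → Bool) {v : ℕ} → v ∈₁ tabulate₁ n f → f v ≡ true
∈₁-tabulate₁⁻ {n = suc n} f {suc zero}    v∈ with f 1 | v∈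
... | true | here = refl
∈₁-tabulate₁⁻ {n = suc n} f {suc (suc v)} (there v∈) = ∈₁-tabulate₁⁻ (λ v → f (suc v)) v∈

-- `rank p v` counts the members of p in [1, v]; `select p j` is the j-th smallest member of p.
rank : Subset n → ℕ → ℕ
rank []          _       = 0
rank (_ ∷ _)     zero    = 0
rank (true  ∷ p) (suc v) = suc (rank p v)
rank (false ∷ p) (suc v) = rank p v

select : Subset n → ℕ → ℕ
select _           zero    = 0
select []          (suc _) = 0
select (true  ∷ p) (suc j) = suc (select p j)
select (false ∷ p) (suc j) = suc (select p (suc j))

rank-zero : (p : Subset n) → rank p 0 ≡ 0
rank-zero []      = refl
rank-zero (_ ∷ _) = refl

rank-mono : (p : Subset n) {v w : ℕ} → v ≤ w → rank p v ≤ rank p w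
rank-mono []          _                         = z≤n
rank-mono (_     ∷ _) {zero}                 _  = z≤n
rank-mono (true  ∷ p) {suc v} {suc w} (s≤s v≤w) = s≤s (rank-mono p v≤w)
rank-mono (false ∷ p) {suc v} {suc w} (s≤s v≤w) = rank-mono p v≤w

rank≤∣∣ : (p : Subset n) (v : ℕ) → rank p v ≤ ∣ p ∣
rank≤∣∣ []          _       = z≤n
rank≤∣∣ (_     ∷ _) zero    = z≤n
rank≤∣∣ (true  ∷ p) (suc v) = s≤s (rank≤∣∣ p v)
rank≤∣∣ (false ∷ p) (suc v) = rank≤∣∣ p v

rank-∣∣ : (p : Subset n) → rank p n ≡ ∣ p ∣
rank-∣∣ []          = refl
rank-∣∣ (true  ∷ p) = cong suc (rank-∣∣ p)
rank-∣∣ (false ∷ p) = rank-∣∣ p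

rank-suc-∈ : (p : Subset n) {v : ℕ} → suc v ∈₁ p → rank p (suc v) ≡ suc (rank p v)
rank-suc-∈ (true  ∷ p) here        = cong suc (rank-zero p)
rank-suc-∈ (true  ∷ p) (there v∈p) = cong suc (rank-suc-∈ p v∈p)
rank-suc-∈ (false ∷ p) (there v∈p) = rank-suc-∈ p v∈p

rank-suc-∉ : (p : Subset n) {v : ℕ} → suc v ∉₁ p → rank p (suc v) ≡ rank p v
rank-suc-∉ []          _         = refl
rank-suc-∉ (true  ∷ p) {zero}  v∉p = ⊥-elim (v∉p here)
rank-suc-∉ (false ∷ p) {zero}  _   = rank-zero p
rank-suc-∉ (true  ∷ p) {suc v} v∉p = cong suc (rank-suc-∉ p (v∉p ∘ there))
rank-suc-∉ (false ∷ p) {suc v} v∉p = rank-suc-∉ p (v∉p ∘ there)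

rank-< : (p : Subset n) {v w : ℕ} → w ∈₁ p → v < w → rank p v < rank p w
rank-< p {v} {suc w} w∈p (s≤s v≤w) =
  subst (rank p v <_) (sym (rank-suc-∈ p w∈p)) (s≤s (rank-mono p v≤w))

rank-positive : (p : Subset n) {v : ℕ} → v ∈₁ p → 1 ≤ rank p v
rank-positive p {v} v∈p = subst (_< rank p v) (rank-zero p) (rank-< p v∈p (proj₁ (∈₁-range v∈p)))

rank-cancel-< : (p : Subset n) {v w : ℕ} → rank p v < rank p w → v < w
rank-cancel-< p r< = ≰⇒> (λ w≤v → <⇒≱ r< (rank-mono p w≤v))

rank-injective : (p : Subset n) {v w : ℕ} → v ∈₁ p → w ∈₁ p → rank p v ≡ rank p w → v ≡ w
rank-injective p {v} {w} v∈p w∈p eq with <-cmp v w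
... | tri< v<w _ _ = ⊥-elim (<-irrefl eq (rank-< p w∈p v<w))
... | tri≈ _ v≡w _ = v≡w
... | tri> _ _ w<v = ⊥-elim (<-irrefl (sym eq) (rank-< p v∈p w<v))

rank-gap : (p : Subset n) {a b : ℕ} → a ≤ b → (∀ {u} → a < u → u ≤ b → u ∉₁ p) →
           rank p b ≡ rank p a
rank-gap p a≤b gap with m≤n⇒m<n∨m≡n a≤b
... | inj₂ refl = refl
... | inj₁ (s≤s a≤b′) =
  trans (rank-suc-∉ p (gap (s≤s a≤b′) ≤-refl))
        (rank-gap p a≤b′ λ a<u u≤b′ → gap a<u (m≤n⇒m≤1+n u≤b′))

rank-next : (p : Subset n) {v w : ℕ} → v < w → w ∈₁ p → (∀ {u} → v < u → u < w → u ∉₁ p) →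
            rank p w ≡ suc (rank p v)
rank-next p {v} {suc w} (s≤s v≤w) w∈p gap =
  trans (rank-suc-∈ p w∈p) (cong suc (rank-gap p v≤w λ v<u u≤w → gap v<u (s≤s u≤w)))

Above⇒rank≡0 : (p : Subset n) {k : ℕ} → Above k p → rank p k ≡ 0
Above⇒rank≡0 p above = trans (rank-gap p z≤n λ _ u≤k u∈p → <⇒≱ (above u∈p) u≤k) (rank-zero p)

rank-∁ : (p : Subset n) {v : ℕ} → v ≤ n → rank (∁ p) v + rank p v ≡ v
rank-∁ []          {zero}  _         = refl
rank-∁ (_     ∷ _) {zero}  _         = refl
rank-∁ (true  ∷ p) {suc v} (s≤s v≤n) = trans (+-suc _ _) (cong suc (rank-∁ p v≤n))
rank-∁ (false ∷ p) {suc v} (s≤s v≤n) = cong suc (rank-∁ p v≤n)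

Above⇒rank-∁ : (p : Subset n) {k : ℕ} → Above k p → k ≤ n → rank (∁ p) k ≡ k
Above⇒rank-∁ p {k} above k≤n = begin
  rank (∁ p) k              ≡⟨ sym (+-identityʳ _) ⟩
  rank (∁ p) k + 0          ≡⟨ cong (rank (∁ p) k +_) (sym (Above⇒rank≡0 p above)) ⟩
  rank (∁ p) k + rank p k   ≡⟨ rank-∁ p k≤n ⟩
  k                         ∎
  where open ≡-Reasoning

select-rank : (p : Subset n) {v : ℕ} → v ∈₁ p → select p (rank p v) ≡ v
select-rank (true  ∷ p) here                  = cong (λ j → suc (select p j)) (rank-zero p)
select-rank (true  ∷ p) (there v∈p)           = cong suc (select-rank p v∈p)
select-rank (false ∷ p) (there {v = v} v∈p)
  with rank p (suc v) | select-rank p v∈p | rank-positive p v∈p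
... | suc j | eq | _ = cong suc eq

rank-select : (p : Subset n) {j : ℕ} → 1 ≤ j → j ≤ ∣ p ∣ →
              select p j ∈₁ p × rank p (select p j) ≡ j
rank-select (true  ∷ p) {suc zero}    _ _ = here , cong suc (rank-zero p)
rank-select (true  ∷ p) {suc (suc j)} _ (s≤s j<) with select p (suc j) | rank-select p {suc j} z<s j<
... | suc s | s∈p , eq = there s∈p , cong suc eq
rank-select (false ∷ p) {suc j}       _ j≤ with select p (suc j) | rank-select p {suc j} z<s j≤
... | suc s | s∈p , eq = there s∈p , eq

IncreasingOn : ℕ → ℕ → (ℕ → ℕ) → Set
IncreasingOn a b f = ∀ {p} → a ≤ p → suc p ≤ b → f p < f (suc p)

module _ {a b : ℕ} {f : ℕ → ℕ} (inc : IncreasingOn a b f) where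

  increasing-+∸ : ∀ {p q} → a ≤ p → p ≤ q → q ≤ b → f p + (q ∸ p) ≤ f q
  increasing-+∸ {p} {q} a≤p p≤q q≤b with m≤n⇒m<n∨m≡n p≤q
  ... | inj₂ refl = ≤-reflexive (trans (cong (f p +_) (n∸n≡0 p)) (+-identityʳ (f p)))
  ... | inj₁ (s≤s {n = q′} p≤q′) = begin
    f p + (suc q′ ∸ p)     ≡⟨ cong (f p +_) (+-∸-assoc 1 p≤q′) ⟩
    f p + suc (q′ ∸ p)     ≡⟨ +-suc (f p) (q′ ∸ p) ⟩
    suc (f p + (q′ ∸ p))   ≤⟨ s≤s (increasing-+∸ a≤p p≤q′ (<⇒≤ q≤b)) ⟩
    suc (f q′)             ≤⟨ inc (≤-trans a≤p p≤q′) q≤b ⟩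
    f (suc q′)             ∎
    where open ≤-Reasoning

  increasing-< : ∀ {p q} → a ≤ p → p < q → q ≤ b → f p < f q
  increasing-< {p} a≤p p<q q≤b =
    <-≤-trans (m<m+n (f p) (m<n⇒0<n∸m p<q)) (increasing-+∸ a≤p (<⇒≤ p<q) q≤b)

  increasing-≤ : ∀ {p q} → a ≤ p → p ≤ q → q ≤ b → f p ≤ f q
  increasing-≤ {p} a≤p p≤q q≤b = ≤-trans (m≤m+n (f p) _) (increasing-+∸ a≤p p≤q q≤b)

  increasing-cancel-< : ∀ {p q} → a ≤ q → p ≤ b → f p < f q → p < q
  increasing-cancel-< {p} {q} a≤q p≤b fp<fq with <-cmp p q
  ... | tri< p<q _ _ = p<q
  ... | tri≈ _ refl _ = ⊥-elim (<-irrefl refl fp<fq)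
  ... | tri> _ _ q<p = ⊥-elim (<-asym fp<fq (increasing-< a≤q q<p p≤b))

module _ (p : Subset n) {a b : ℕ} {f : ℕ → ℕ} (inc : IncreasingOn a b f)
         (enum : ∀ {v} → v ∈₁ p → ∃[ q ] a < q × q ≤ b × f q ≡ v)
         (f∈p : ∀ {q} → a < q → q ≤ b → f q ∈₁ p) where

  rank-enumeration : ∀ {q} → a ≤ q → q ≤ b → rank p (f q) ≡ q ∸ a
  rank-enumeration {q} a≤q q≤b with m≤n⇒m<n∨m≡n a≤q
  ... | inj₂ refl = trans (Above⇒rank≡0 p above) (sym (n∸n≡0 a))
    where
    above : Above (f a) p
    above v∈p with enum v∈p
    ... | r , a<r , r≤b , refl = increasing-< inc ≤-refl a<r r≤b
  ... | inj₁ (s≤s {n = q′} a≤q′) = begin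
    rank p (f (suc q′))     ≡⟨ rank-next p fq′<fq (f∈p (s≤s a≤q′) q≤b) gap ⟩
    suc (rank p (f q′))     ≡⟨ cong suc (rank-enumeration a≤q′ (<⇒≤ q≤b)) ⟩
    suc (q′ ∸ a)            ≡⟨ sym (+-∸-assoc 1 a≤q′) ⟩
    suc q′ ∸ a              ∎
    where
    open ≡-Reasoning
    fq′<fq : f q′ < f (suc q′)
    fq′<fq = inc a≤q′ q≤b
    gap : ∀ {u} → f q′ < u → u < f (suc q′) → u ∉₁ p
    gap fq′<u u<fq u∈p with enum u∈p
    ... | r , a<r , r≤b , refl =
      <⇒≱ (increasing-cancel-< inc (<⇒≤ a<r) (<⇒≤ q≤b) fq′<u)
          (≤-pred (increasing-cancel-< inc (≤-trans a≤q′ (n≤1+n q′)) r≤b u<fq))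

  ∣∣-enumeration : a ≤ b → f b ≤ n → ∣ p ∣ ≡ b ∸ a
  ∣∣-enumeration a≤b fb≤n = begin
    ∣ p ∣          ≡⟨ sym (rank-∣∣ p) ⟩
    rank p n       ≡⟨ rank-gap p fb≤n nothing-above ⟩
    rank p (f b)   ≡⟨ rank-enumeration a≤b ≤-refl ⟩
    b ∸ a          ∎
    where
    open ≡-Reasoning
    nothing-above : ∀ {u} → f b < u → u ≤ n → u ∉₁ p
    nothing-above fb<u _ u∈p with enum u∈p
    ... | r , a<r , r≤b , refl = <⇒≱ fb<u (increasing-≤ inc (<⇒≤ a<r) r≤b ≤-refl)

record Inversion (h f : ℕ → ℕ) (n i j : ℕ) : Set where
  constructor inversion
  field
    1≤i     : 1 ≤ i
    i<j     : i < j
    j≤n     : j ≤ n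
    j≤h[i]  : j ≤ h i
    descent : f j < f i

module _ (h : ℕ → ℕ) (π : Vec ℕ n) where

  invH⇒inversion : ∀ {i j} → InvH h π i j → Inversion h (π !_) n i j
  invH⇒inversion (a , b , refl , refl , i<j , j≤hi , πb<πa) =
    inversion z<s i<j (toℕ<n b) j≤hi (subst₂ _<_ (sym (!-lookup π b)) (sym (!-lookup π a)) πb<πa)

  inversion⇒invH : ∀ {i j} → Inversion h (π !_) n i j → InvH h π i j
  inversion⇒invH {suc i} {suc j} (inversion _ i<j j≤n j≤hi πj<πi) =
    fromℕ< i<n , fromℕ< j≤n , cong suc (sym (toℕ-fromℕ< i<n)) , cong suc (sym (toℕ-fromℕ< j≤n)) ,
    i<j , j≤hi , subst₂ _<_ (!-fromℕ< π j≤n) (!-fromℕ< π i<n) πj<πi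
    where
    i<n : i < n
    i<n = <-trans (≤-pred i<j) j≤n

invEq-resp : (h : ℕ → ℕ) {S : PairSet} {n′ : ℕ} (π : Vec ℕ n) (σ : Vec ℕ n′) →
             (∀ {i j} → Inversion h (π !_) n i j ⇔ Inversion h (σ !_) n′ i j) →
             InvEq h π S → InvEq h σ S
invEq-resp h π σ same π-inv i j = mk⇔
  (λ s → inversion⇒invH h σ (Equivalence.to same (invH⇒inversion h π (Equivalence.to (π-inv i j) s))))
  (λ inv → Equivalence.from (π-inv i j)
             (inversion⇒invH h π (Equivalence.from same (invH⇒inversion h σ inv))))

Entry : Vec ℕ n → ℕ → ℕ → Set
Entry {n} π q k = Σ (Fin n) λ a → suc (toℕ a) ≡ q × lookup π a ≡ k

entry⇒! : (π : Vec ℕ n) {q k : ℕ} → Entry π q k → 1 ≤ q × q ≤ n × π ! q ≡ k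
entry⇒! π (a , refl , refl) = z<s , toℕ<n a , !-lookup π a

!⇒entry : (π : Vec ℕ n) {q k : ℕ} → 1 ≤ q → q ≤ n → π ! q ≡ k → Entry π q k
!⇒entry π {suc q} _ q<n refl = fromℕ< q<n , cong suc (toℕ-fromℕ< q<n) , sym (!-fromℕ< π q<n)

aboveₛ⇒Above : (p : Subset n) {k : ℕ} → (∀ a → a ∈ₛ p → suc k ≤ suc (toℕ a)) → Above k p
aboveₛ⇒Above p above v∈p with ∈₁⇒∃∈ₛ v∈p
... | a , refl , a∈p = above a a∈p

Above⇒aboveₛ : (p : Subset n) {k : ℕ} → Above k p → ∀ a → a ∈ₛ p → suc k ≤ suc (toℕ a)
Above⇒aboveₛ p above a a∈p = above (∈ₛ⇒∈₁ a∈p)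

module Splitting {H n : ℕ} (H≤n : H ≤ n) where

  occursAfterH : Vec ℕ n → ℕ → Bool
  occursAfterH π v = does (v ∈? List.drop H (toList π))

  tailSet : Vec ℕ n → Subset n
  tailSet π = tabulate₁ n (occursAfterH π)

  standardizedHead : Vec ℕ n → Vec ℕ H
  standardizedHead π = tabulate₁ H λ i → rank (∁ (tailSet π)) (π ! i)

  split : Vec ℕ n → Vec ℕ H × Subset n
  split π = standardizedHead π , tailSet π

  mergedEntry : Vec ℕ H → Subset n → ℕ → ℕ
  mergedEntry σ T q = if does (q ≤? H) then select (∁ T) (σ ! q) else select T (q ∸ H)

  merge : Vec ℕ H × Subset n → Vec ℕ n
  merge (σ , T) = tabulate₁ n (mergedEntry σ T)

  -- σ is the standardization of π₁ ⋯ π_H, and π_{H+1} < ⋯ < π_n enumerate T.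
  record Splits (π : Vec ℕ n) (σ : Vec ℕ H) (T : Subset n) : Set where
    field
      card      : ∣ T ∣ ≡ n ∸ H
      head-∈    : ∀ {i} → 1 ≤ i → i ≤ H → π ! i ∈₁ ∁ T
      head-rank : ∀ {i} → 1 ≤ i → i ≤ H → rank (∁ T) (π ! i) ≡ σ ! i
      tail-∈    : ∀ {q} → H < q → q ≤ n → π ! q ∈₁ T
      tail-rank : ∀ {q} → H < q → q ≤ n → rank T (π ! q) ≡ q ∸ H

  ∣∁∣≡H : (T : Subset n) → ∣ T ∣ ≡ n ∸ H → ∣ ∁ T ∣ ≡ H
  ∣∁∣≡H T card = trans (∣∁p∣≡n∸∣p∣ T) (trans (cong (n ∸_) card) (m∸[m∸n]≡n H≤n))

  module _ (π : Vec ℕ n) where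

    ∈₁-tailSet⁺ : ∀ {v} → 1 ≤ v × v ≤ n → v ∈ List.drop H (toList π) → v ∈₁ tailSet π
    ∈₁-tailSet⁺ (1≤v , v≤n) v∈ = ∈₁-tabulate₁⁺ (occursAfterH π) 1≤v v≤n (dec-true (_ ∈? _) v∈)

    ∈₁-tailSet⁻ : ∀ {v} → v ∈₁ tailSet π → ∃[ q ] H < q × q ≤ n × π ! q ≡ v
    ∈₁-tailSet⁻ {v} v∈T
      with v ∈? List.drop H (toList π) | ∈₁-tabulate₁⁻ (occursAfterH π) v∈T
    ... | yes v∈ | _  = ∈-drop⇒! π H v∈
    ... | no  _  | ()

    split-splits : Permutes n (π !_) → IncreasingOn H n (π !_) →
                   Splits π (standardizedHead π) (tailSet π)
    split-splits perm inc = record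
      { card      = ∣∣-enumeration T inc ∈₁-tailSet⁻ tail-∈ H≤n (permutes-last π perm)
      ; head-∈    = λ 1≤i i≤H → let (1≤πi , πi≤n) = bounded 1≤i (≤-trans i≤H H≤n) in
                               ∉₁⇒∈₁∁ T 1≤πi πi≤n (head-∉ 1≤i i≤H)
      ; head-rank = λ 1≤i i≤H → sym (!-tabulate₁ (λ i → rank (∁ T) (π ! i)) 1≤i i≤H)
      ; tail-∈    = tail-∈
      ; tail-rank = λ H<q q≤n → rank-enumeration T inc ∈₁-tailSet⁻ tail-∈ (<⇒≤ H<q) q≤n
      }
      where
      open Permutes perm
      T = tailSet π
      tail-∈ : ∀ {q} → H < q → q ≤ n → π ! q ∈₁ T
      tail-∈ H<q q≤n = ∈₁-tailSet⁺ (bounded (≤-<-trans z≤n H<q) q≤n) (!-∈-drop π H<q q≤n)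
      head-∉ : ∀ {i} → 1 ≤ i → i ≤ H → π ! i ∉₁ T
      head-∉ 1≤i i≤H πi∈T with ∈₁-tailSet⁻ πi∈T
      ... | q , H<q , q≤n , πq≡πi =
        <⇒≱ H<q (subst (_≤ H) (injective 1≤i (≤-trans i≤H H≤n) (≤-<-trans z≤n H<q) q≤n (sym πq≡πi)) i≤H)

  module _ (σ : Vec ℕ H) (T : Subset n) where

    merge-head : ∀ {i} → 1 ≤ i → i ≤ H → merge (σ , T) ! i ≡ select (∁ T) (σ ! i)
    merge-head {i} 1≤i i≤H = trans (!-tabulate₁ (mergedEntry σ T) 1≤i (≤-trans i≤H H≤n))
      (cong (λ b → if b then select (∁ T) (σ ! i) else select T (i ∸ H)) (dec-true (i ≤? H) i≤H))

    merge-tail : ∀ {q} → H < q → q ≤ n → merge (σ , T) ! q ≡ select T (q ∸ H)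
    merge-tail {q} H<q q≤n = trans (!-tabulate₁ (mergedEntry σ T) (≤-<-trans z≤n H<q) q≤n)
      (cong (λ b → if b then select (∁ T) (σ ! q) else select T (q ∸ H))
            (dec-false (q ≤? H) (<⇒≱ H<q)))

    merge-splits : (∀ {i} → 1 ≤ i → i ≤ H → 1 ≤ σ ! i × σ ! i ≤ H) → ∣ T ∣ ≡ n ∸ H →
                   Splits (merge (σ , T)) σ T
    merge-splits σ-bounded card = record
      { card      = card
      ; head-∈    = λ 1≤i i≤H → subst (_∈₁ ∁ T) (sym (merge-head 1≤i i≤H)) (proj₁ (head 1≤i i≤H))
      ; head-rank = λ 1≤i i≤H → trans (cong (rank (∁ T)) (merge-head 1≤i i≤H)) (proj₂ (head 1≤i i≤H))
      ; tail-∈    = λ H<q q≤n → subst (_∈₁ T) (sym (merge-tail H<q q≤n)) (proj₁ (tail H<q q≤n))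
      ; tail-rank = λ H<q q≤n → trans (cong (rank T) (merge-tail H<q q≤n)) (proj₂ (tail H<q q≤n))
      }
      where
      head : ∀ {i} → 1 ≤ i → i ≤ H →
             select (∁ T) (σ ! i) ∈₁ ∁ T × rank (∁ T) (select (∁ T) (σ ! i)) ≡ σ ! i
      head {i} 1≤i i≤H = let (1≤σi , σi≤H) = σ-bounded 1≤i i≤H in
        rank-select (∁ T) 1≤σi (subst (σ ! i ≤_) (sym (∣∁∣≡H T card)) σi≤H)
      tail : ∀ {q} → H < q → q ≤ n → select T (q ∸ H) ∈₁ T × rank T (select T (q ∸ H)) ≡ q ∸ H
      tail {q} H<q q≤n = rank-select T (m<n⇒0<n∸m H<q) (subst (q ∸ H ≤_) (sym card) (∸-monoˡ-≤ H q≤n))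

  module _ {π : Vec ℕ n} {σ : Vec ℕ H} {T : Subset n} (sp : Splits π σ T) where
    open Splits sp

    splits⇒merge : merge (σ , T) ≡ π
    splits⇒merge = !-ext _ _ same
      where
      same : ∀ {q} → 1 ≤ q → q ≤ n → merge (σ , T) ! q ≡ π ! q
      same {q} 1≤q q≤n with ≤-<-connex q H
      ... | inj₁ q≤H = trans (merge-head σ T 1≤q q≤H)
        (trans (cong (select (∁ T)) (sym (head-rank 1≤q q≤H))) (select-rank (∁ T) (head-∈ 1≤q q≤H)))
      ... | inj₂ H<q = trans (merge-tail σ T H<q q≤n)
        (trans (cong (select T) (sym (tail-rank H<q q≤n))) (select-rank T (tail-∈ H<q q≤n)))

    tailSet≡ : tailSet π ≡ T
    tailSet≡ = ∈₁-ext _ _ tailSet⊆T T⊆tailSet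
      where
      tailSet⊆T : ∀ {v} → v ∈₁ tailSet π → v ∈₁ T
      tailSet⊆T v∈ with ∈₁-tailSet⁻ π v∈
      ... | q , H<q , q≤n , refl = tail-∈ H<q q≤n
      T⊆tailSet : ∀ {v} → v ∈₁ T → v ∈₁ tailSet π
      T⊆tailSet {v} v∈T = ∈₁-tailSet⁺ π (∈₁-range v∈T) (subst (_∈ _) πq≡v (!-∈-drop π H<q q≤n))
        where
        q = H + rank T v
        H<q : H < q
        H<q = m<m+n H (rank-positive T v∈T)
        q≤n : q ≤ n
        q≤n = subst (q ≤_) (m+[n∸m]≡n H≤n) (+-monoʳ-≤ H (subst (rank T v ≤_) card (rank≤∣∣ T v)))
        πq≡v : π ! q ≡ v
        πq≡v = rank-injective T (tail-∈ H<q q≤n) v∈T (trans (tail-rank H<q q≤n) (m+n∸m≡n H (rank T v)))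

    splits⇒split : split π ≡ (σ , T)
    splits⇒split = cong₂ _,_ (!-ext _ _ head≡) tailSet≡
      where
      head≡ : ∀ {i} → 1 ≤ i → i ≤ H → standardizedHead π ! i ≡ σ ! i
      head≡ {i} 1≤i i≤H = trans (!-tabulate₁ (λ i → rank (∁ (tailSet π)) (π ! i)) 1≤i i≤H)
        (trans (cong (λ T′ → rank (∁ T′) (π ! i)) tailSet≡) (head-rank 1≤i i≤H))

    splits⇒permutes-head : Permutes n (π !_) → Permutes H (σ !_)
    splits⇒permutes-head perm = record
      { bounded   = λ 1≤i i≤H → subst (λ s → 1 ≤ s × s ≤ H) (head-rank 1≤i i≤H)
                      (rank-positive (∁ T) (head-∈ 1≤i i≤H) , subst (_ ≤_) (∣∁∣≡H T card) (rank≤∣∣ (∁ T) _))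
      ; injective = λ 1≤i i≤H 1≤j j≤H σi≡σj →
                      Permutes.injective perm 1≤i (≤-trans i≤H H≤n) 1≤j (≤-trans j≤H H≤n)
                        (rank-injective (∁ T) (head-∈ 1≤i i≤H) (head-∈ 1≤j j≤H)
                          (trans (head-rank 1≤i i≤H) (trans σi≡σj (sym (head-rank 1≤j j≤H)))))
      }

    splits⇒permutes : Permutes H (σ !_) → Permutes n (π !_)
    splits⇒permutes perm = record { bounded = bounded ; injective = injective }
      where
      bounded : ∀ {q} → 1 ≤ q → q ≤ n → 1 ≤ π ! q × π ! q ≤ n
      bounded {q} 1≤q q≤n with ≤-<-connex q H
      ... | inj₁ q≤H = ∈₁-range (head-∈ 1≤q q≤H)
      ... | inj₂ H<q = ∈₁-range (tail-∈ H<q q≤n)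
      injective : ∀ {p q} → 1 ≤ p → p ≤ n → 1 ≤ q → q ≤ n → π ! p ≡ π ! q → p ≡ q
      injective {p} {q} 1≤p p≤n 1≤q q≤n πp≡πq with ≤-<-connex p H | ≤-<-connex q H
      ... | inj₁ p≤H | inj₁ q≤H = Permutes.injective perm 1≤p p≤H 1≤q q≤H
        (trans (sym (head-rank 1≤p p≤H)) (trans (cong (rank (∁ T)) πp≡πq) (head-rank 1≤q q≤H)))
      ... | inj₁ p≤H | inj₂ H<q =
        ⊥-elim (∈₁∁⇒∉₁ T (head-∈ 1≤p p≤H) (subst (_∈₁ T) (sym πp≡πq) (tail-∈ H<q q≤n)))
      ... | inj₂ H<p | inj₁ q≤H =
        ⊥-elim (∈₁∁⇒∉₁ T (head-∈ 1≤q q≤H) (subst (_∈₁ T) πp≡πq (tail-∈ H<p p≤n)))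
      ... | inj₂ H<p | inj₂ H<q = ∸-cancelʳ-≡ (<⇒≤ H<p) (<⇒≤ H<q)
        (trans (sym (tail-rank H<p p≤n)) (trans (cong (rank T) πp≡πq) (tail-rank H<q q≤n)))

    splits-descent : ∀ {i j} → 1 ≤ i → i ≤ H → 1 ≤ j → j ≤ H → π ! j < π ! i ⇔ σ ! j < σ ! i
    splits-descent 1≤i i≤H 1≤j j≤H = mk⇔
      (λ πj<πi → subst₂ _<_ (head-rank 1≤j j≤H) (head-rank 1≤i i≤H) (rank-< (∁ T) (head-∈ 1≤i i≤H) πj<πi))
      (λ σj<σi → rank-cancel-< (∁ T) (subst₂ _<_ (sym (head-rank 1≤j j≤H)) (sym (head-rank 1≤i i≤H)) σj<σi))

    splits-increasing : ∀ {a} → 1 ≤ a → Above (π ! H) T → IncreasingOn a H (σ !_) →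
                        IncreasingOn a n (π !_)
    splits-increasing 1≤a T>πH σ-inc {p} a≤p p<n with <-cmp p H
    ... | tri< p<H _ _ = Equivalence.from (splits-descent z<s p<H 1≤p (<⇒≤ p<H)) (σ-inc a≤p p<H)
      where 1≤p = ≤-trans 1≤a a≤p
    ... | tri≈ _ refl _ = T>πH (tail-∈ ≤-refl p<n)
    ... | tri> _ _ H<p = rank-cancel-< T
      (subst₂ _<_ (sym (tail-rank H<p (<⇒≤ p<n))) (sym (tail-rank (m<n⇒m<1+n H<p) p<n))
                  (∸-monoˡ-< (n<1+n p) (<⇒≤ H<p)))

    splits-at-H : ∀ {k} → 1 ≤ H → Above k T → 1 ≤ k × k ≤ n → π ! H ≡ k ⇔ σ ! H ≡ k
    splits-at-H {k} 1≤H T>k (1≤k , k≤n) = mk⇔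
      (λ πH≡k → trans (sym (head-rank 1≤H ≤-refl)) (trans (cong (rank (∁ T)) πH≡k) rank∁k≡k))
      (λ σH≡k → rank-injective (∁ T) (head-∈ 1≤H ≤-refl) k∈∁T
                  (trans (head-rank 1≤H ≤-refl) (trans σH≡k (sym rank∁k≡k))))
      where
      rank∁k≡k : rank (∁ T) k ≡ k
      rank∁k≡k = Above⇒rank-∁ T T>k k≤n
      k∈∁T : k ∈₁ ∁ T
      k∈∁T = ∉₁⇒∈₁∁ T 1≤k k≤n (λ k∈T → <-irrefl refl (T>k k∈T))

inversions-confined : {h : ℕ → ℕ} → WeaklyIncreasing h → (m : ℕ) {f : ℕ → ℕ} →
                      IncreasingOn (suc m) n f → ∀ {i j} → Inversion h f n i j → j ≤ h m
inversions-confined h-mono m inc {i} (inversion 1≤i i<j j≤n j≤hi fj<fi) with m <? i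
... | yes m<i = ⊥-elim (<-asym fj<fi (increasing-< inc m<i i<j j≤n))
... | no  m≮i = ≤-trans j≤hi (h-mono _ _ 1≤i (≮⇒≥ m≮i))

module _ {h : ℕ → ℕ} {S : PairSet} {m : ℕ} where

  m-positive : (π : Vec ℕ n) → InvEq h π S → IsM S m → 1 ≤ m
  m-positive π π-inv (m∈S , _) =
    Inversion.1≤i (invH⇒inversion h π (Equivalence.to (π-inv m (suc m)) m∈S))

  valid⇒increasing : Expansive h → IsM S m → (π : Vec ℕ n) → InI h S n π →
                     IncreasingOn (suc m) n (π !_)
  valid⇒increasing h-exp (_ , m-max) π (π↭ , π-inv) {p} m<p p<n = ≤∧≢⇒< (≮⇒≥ no-descent) distinct
    where
    1≤p = ≤-<-trans z≤n m<p
    distinct : π ! p ≢ π ! suc p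
    distinct πp≡πp+1 =
      1+n≢n (sym (Permutes.injective (isPerm⇒permutes π π↭) 1≤p (<⇒≤ p<n) z<s p<n πp≡πp+1))
    -- A descent at p > m would put the h-inversion (p, p + 1) into S, contradicting maximality of m.
    no-descent : ¬ (π ! suc p < π ! p)
    no-descent πp+1<πp = <⇒≱ m<p (m-max p (Equivalence.from (π-inv p (suc p))
      (inversion⇒invH h π (inversion 1≤p (n<1+n p) p<n (h-exp p 1≤p) πp+1<πp))))

  valid-bounds : Expansive h → IsM S m → (π : Vec ℕ n) → InI h S n π → m < h m → h m ≤ n →
                 h m ∸ m ≤ π ! h m × π ! h m ≤ h m
  valid-bounds {n} h-exp m-max π valid m<H H≤n = lower , upper
    where
    H = h m
    perm = isPerm⇒permutes π (proj₁ valid)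
    inc = valid⇒increasing h-exp m-max π valid
    lower : H ∸ m ≤ π ! H
    lower = subst (_≤ π ! H) (sym (+-∸-assoc 1 m<H))
      (≤-trans (+-monoˡ-≤ (H ∸ suc m) (proj₁ (Permutes.bounded perm z<s (≤-trans m<H H≤n))))
               (increasing-+∸ inc ≤-refl m<H H≤n))
    upper : π ! H ≤ H
    upper = +-cancelʳ-≤ (n ∸ H) (π ! H) H
      (≤-trans (increasing-+∸ inc m<H H≤n ≤-refl)
               (subst (π ! n ≤_) (sym (m+[n∸m]≡n H≤n)) (permutes-last π perm)))

module Bijection {h : ℕ → ℕ} (h-mono : WeaklyIncreasing h) (h-exp : Expansive h)
                 {S : PairSet} {m : ℕ} (m-max : IsM S m) (1≤m : 1 ≤ m) {n : ℕ} (H≤n : h m ≤ n) where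

  open Splitting H≤n

  private
    m<H : m < h m
    m<H = h-exp m 1≤m
    1≤H : 1 ≤ h m
    1≤H = ≤-<-trans z≤n m<H
    increasing : ∀ {n′} (π : Vec ℕ n′) → InI h S n′ π → IncreasingOn (suc m) n′ (π !_)
    increasing = valid⇒increasing h-exp m-max

  module _ {π : Vec ℕ n} {σ : Vec ℕ (h m)} {T : Subset n}
           (sp : Splits π σ T) (inc : IncreasingOn (suc m) n (π !_)) where

    splits-inversion⇔ : ∀ {i j} → Inversion h (π !_) n i j ⇔ Inversion h (σ !_) (h m) i j
    splits-inversion⇔ = mk⇔ to from
      where
      descent : ∀ {i j} → 1 ≤ i → i < j → j ≤ h m → π ! j < π ! i ⇔ σ ! j < σ ! i
      descent 1≤i i<j j≤H = splits-descent sp 1≤i (≤-trans (<⇒≤ i<j) j≤H) (≤-trans 1≤i (<⇒≤ i<j)) j≤H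
      to : ∀ {i j} → Inversion h (π !_) n i j → Inversion h (σ !_) (h m) i j
      to inv@(inversion 1≤i i<j _ j≤hi πj<πi) =
        inversion 1≤i i<j j≤H j≤hi (Equivalence.to (descent 1≤i i<j j≤H) πj<πi)
        where j≤H = inversions-confined h-mono m inc inv
      from : ∀ {i j} → Inversion h (σ !_) (h m) i j → Inversion h (π !_) n i j
      from (inversion 1≤i i<j j≤H j≤hi σj<σi) =
        inversion 1≤i i<j (≤-trans j≤H H≤n) j≤hi (Equivalence.from (descent 1≤i i<j j≤H) σj<σi)

    splits-InI⇔ : InI h S n π ⇔ InI h S (h m) σ
    splits-InI⇔ = mk⇔
      (λ (π↭ , π-inv) → permutes⇒isPerm σ (splits⇒permutes-head sp (isPerm⇒permutes π π↭)) ,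
                        invEq-resp h π σ splits-inversion⇔ π-inv)
      (λ (σ↭ , σ-inv) → permutes⇒isPerm π (splits⇒permutes sp (isPerm⇒permutes σ σ↭)) ,
                        invEq-resp h σ π (⇔.sym splits-inversion⇔) σ-inv)

  valid-splits : {π : Vec ℕ n} → InI h S n π → Splits π (standardizedHead π) (tailSet π)
  valid-splits {π} valid =
    split-splits π (isPerm⇒permutes π (proj₁ valid)) λ H≤p → increasing π valid (≤-trans m<H H≤p)

  module _ {k : ℕ} where

    split-InB : {π : Vec ℕ n} → InB h S m k n π →
                (InB h S m k (h m) ⊗ InBinom n k (n ∸ h m)) (split π)
    split-InB {π} (valid , entry) = (σ-valid , !⇒entry σ 1≤H ≤-refl σH≡k) , (Above⇒aboveₛ T T>k , card)
      where
      open Splits (valid-splits valid)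
      σ = standardizedHead π
      T = tailSet π
      inc = increasing π valid
      πH≡k : π ! h m ≡ k
      πH≡k = proj₂ (proj₂ (entry⇒! π entry))
      T>k : Above k T
      T>k v∈T with ∈₁-tailSet⁻ π v∈T
      ... | q , H<q , q≤n , refl = subst (_< π ! q) πH≡k (increasing-< inc m<H H<q q≤n)
      k-range : 1 ≤ k × k ≤ n
      k-range = subst (λ x → 1 ≤ x × x ≤ n) πH≡k
                  (Permutes.bounded (isPerm⇒permutes π (proj₁ valid)) 1≤H H≤n)
      σ-valid : InI h S (h m) σ
      σ-valid = Equivalence.to (splits-InI⇔ (valid-splits valid) inc) valid
      σH≡k : σ ! h m ≡ k
      σH≡k = Equivalence.to (splits-at-H (valid-splits valid) 1≤H T>k k-range) πH≡k

    merge-InB : {σT : Vec ℕ (h m) × Subset n} → (InB h S m k (h m) ⊗ InBinom n k (n ∸ h m)) σT →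
                InB h S m k n (merge σT)
    merge-InB {σ , T} ((σ-valid , entry) , (T>ₛk , card)) = π-valid , !⇒entry π 1≤H H≤n πH≡k
      where
      σ-perm = isPerm⇒permutes σ (proj₁ σ-valid)
      sp = merge-splits σ T (Permutes.bounded σ-perm) card
      π = merge (σ , T)
      σH≡k : σ ! h m ≡ k
      σH≡k = proj₂ (proj₂ (entry⇒! σ entry))
      T>k : Above k T
      T>k = aboveₛ⇒Above T T>ₛk
      k-range : 1 ≤ k × k ≤ n
      k-range with Permutes.bounded σ-perm 1≤H ≤-refl
      ... | 1≤σH , σH≤H = subst (1 ≤_) σH≡k 1≤σH , ≤-trans (subst (_≤ h m) σH≡k σH≤H) H≤n
      πH≡k : π ! h m ≡ k
      πH≡k = Equivalence.from (splits-at-H sp 1≤H T>k k-range) σH≡k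
      π-valid : InI h S n π
      π-valid = Equivalence.from (splits-InI⇔ sp π-increasing) σ-valid
        where
        π-increasing : IncreasingOn (suc m) n (π !_)
        π-increasing = splits-increasing sp z<s (subst (λ x → Above x T) (sym πH≡k) T>k)
                                         (increasing σ σ-valid)

    merge∘split : {π : Vec ℕ n} → InB h S m k n π → merge (split π) ≡ π
    merge∘split (valid , _) = splits⇒merge (valid-splits valid)

    split∘merge : {σT : Vec ℕ (h m) × Subset n} → (InB h S m k (h m) ⊗ InBinom n k (n ∸ h m)) σT →
                  split (merge σT) ≡ σT
    split∘merge {σ , T} ((σ-valid , _) , (_ , card)) =
      splits⇒split (merge-splits σ T (Permutes.bounded (isPerm⇒permutes σ (proj₁ σ-valid))) card)

inverses⇒subsetBij : {X Y : Set} {A : X → Set} {B : Y → Set} (f : X → Y) (g : Y → X) →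
                     (∀ {x} → A x → B (f x)) → (∀ {y} → B y → A (g y)) →
                     (∀ {x} → A x → g (f x) ≡ x) → (∀ {y} → B y → f (g y) ≡ y) → SubsetBij A B
inverses⇒subsetBij f g f-maps g-maps g∘f f∘g = record
  { fun        = λ (x , a) → f x , f-maps a
  ; resp       = λ _ _ → cong f
  ; injective  = λ (x , a) (x′ , a′) fx≡fx′ →
                   trans (sym (g∘f a)) (trans (cong g fx≡fx′) (g∘f a′))
  ; surjective = λ (y , b) → (g y , g-maps b) , f∘g b
  }

lemma3p1 : (h : ℕ → ℕ) → WeaklyIncreasing h → Expansive h →
           (S : PairSet) → NonemptyPS S → Admissible h S →
           (m : ℕ) → IsM S m →
           (n : ℕ) → h m ≤ n → (k : ℕ) →
           ((Σ (Vec ℕ n) (InB h S m k n)) → (h m ∸ m ≤ k) × (k ≤ h m)) ×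
           ((h m ∸ m ≤ k) → (k ≤ h m) →
             SubsetBij (InB h S m k n)
               (InB h S m k (h m) ⊗ InBinom n k (n ∸ h m)))
lemma3p1 h h-mono h-exp S _ (_ , π₀ , _ , π₀-inv) m m-max n H≤n k = range , λ _ _ → bijection
  where
  1≤m = m-positive π₀ π₀-inv m-max
  open Bijection h-mono h-exp {S = S} m-max 1≤m H≤n
  open Splitting H≤n
  range : Σ (Vec ℕ n) (InB h S m k n) → (h m ∸ m ≤ k) × (k ≤ h m)
  range (π , valid , entry) with entry⇒! π entry
  ... | _ , _ , refl = valid-bounds h-exp m-max π valid (h-exp m 1≤m) H≤n
  bijection : SubsetBij (InB h S m k n) (InB h S m k (h m) ⊗ InBinom n k (n ∸ h m))
  bijection = inverses⇒subsetBij split merge split-InB merge-InB merge∘split split∘merge
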